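{- Let $n\ge 1$ and let $A_n$ be the one-dimensional Clobber configuration consisting of $n$ stones on $n$ consecutive squares of a single row, with colors alternating black, white, black, white, $\dots$ (starting with a black stone). Then, even if moves are not required to alternate between white and black (i.e., for any sequence of legal moves whatsoever), $A_n$ cannot be reduced to fewer than $\lceil n/4\rceil + [n\equiv 3 \pmod 4]$ stones. Here $[P]$ equals $1$ if $P$ holds and $0$ otherwise.
   Context: Clobber is played with black and white stones occupying some squares of a grid board. A move consists of picking up a stone and moving it onto a horizontally or vertically adjacent square occupied by a stone of the opposite color; that opposite-colored stone is removed and replaced by the moved stone. A configuration is reduced to $k$ stones if a sequence of moves ends in a configuration with exactly $k$ stones, none of which can move (no stone is horizontally or vertically adjacent to a stone of the opposite color). -}

module Defs where

open import Data.Nat using (ℕ; zero; suc; _+_; _≡ᵇ_)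
open import Data.Nat.DivMod using (_/_; _%_)
open import Data.Bool using (Bool; true; false; if_then_else_; T?)
open import Data.Maybe using (Maybe; just; nothing; is-just)
open import Data.Fin using (Fin; toℕ)
open import Data.Vec using (Vec; lookup; tabulate; _[_]≔_; count)
open import Data.Vec using (toList)
open import Data.List using (length; filter)
open import Data.Product using (_×_; ∃; ∃-syntax)
open import Data.Sum using (_⊎_)
open import Relation.Binary.PropositionalEquality using (_≡_)
open import Relation.Nullary using (¬_)
open import Relation.Binary.Construct.Closure.ReflexiveTransitive using (Star)

data Color : Set where
  black white : Color

opp : Color → Color
opp black = white
opp white = black

Board : ℕ → Set
Board n = Vec (Maybe Color) n

Adj : ∀ {n} → Fin n → Fin n → Set
Adj i j = (toℕ j ≡ suc (toℕ i)) ⊎ (toℕ i ≡ suc (toℕ j))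

data Move {n : ℕ} : Board n → Board n → Set where
  move : (b : Board n) (i j : Fin n) (c : Color) →
         Adj i j →
         lookup b i ≡ just c →
         lookup b j ≡ just (opp c) →
         Move b ((b [ j ]≔ just c) [ i ]≔ nothing)

Reachable : ∀ {n} → Board n → Board n → Set
Reachable = Star Move

Stuck : ∀ {n} → Board n → Set
Stuck {n} b = (i j : Fin n) (c : Color) → Adj i j →
              lookup b i ≡ just c → ¬ (lookup b j ≡ just (opp c))

stones : ∀ {n} → Board n → ℕ
stones b = length (filter (λ x → T? (is-just x)) (toList b))

ReducesTo : ∀ {n} → Board n → ℕ → Set
ReducesTo b k = ∃[ b' ] (Reachable b b' × Stuck b' × stones b' ≡ k)

isEven : ℕ → Bool
isEven zero = true
isEven (suc m) = if isEven m then false else true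

alternating : (n : ℕ) → Board n
alternating n = tabulate (λ i → just (if isEven (toℕ i) then black else white))

bound : ℕ → ℕ
bound n = (n + 3) / 4 + (if n % 4 ≡ᵇ 3 then 1 else 0)

-- Weigh each maximal block of consecutive stones by bound (ℓ + p), where ℓ is its
-- number of stones and p the number of adjacent equal-coloured pairs in it, and call a
-- row tame when such pairs only occur as the first or the last adjacency of a block.
-- The alternating row is tame of total weight bound n.  A capture only shrinks or
-- splits a single block, and since bound is subadditive with bound (4 + m) = 1 + bound m,
-- a case analysis shows that it keeps the row tame and never decreases the total weight.
-- Finally 4 · bound m ≤ m + 5 shows that in a tame row every block weighs at most its
-- number of stones, so every reachable position has at least bound n stones.
module Submission where

open import Defs
open import Data.Nat using (ℕ; zero; suc; _+_; _*_; _≤_; z≤n; s≤s; _≡ᵇ_; _%_)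
open import Data.Nat.Properties
open import Data.Nat.DivMod using (m/n≡1+[m∸n]/n; [m+n]%n≡m%n)
open import Data.Bool using (Bool; true; false; if_then_else_; T?)
open import Data.Empty using (⊥; ⊥-elim)
open import Data.Unit using (⊤; tt)
open import Data.Maybe using (Maybe; just; nothing; is-just)
open import Data.List using (List; []; _∷_; length; filter)
open import Data.Vec using (_∷_; tabulate; toList; lookup; _[_]≔_)
open import Data.Fin using (Fin; toℕ) renaming (zero to fzero; suc to fsuc)
open import Data.Product using (_×_; _,_; proj₁; proj₂; map₂)
open import Data.Sum using (inj₁; inj₂)
open import Relation.Binary.PropositionalEquality
open import Relation.Binary.Construct.Closure.ReflexiveTransitive using (ε; _◅_)

mod4-induction : (P : ℕ → Set) → P 0 → P 1 → P 2 → P 3 →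
                 (∀ n → P n → P (4 + n)) → ∀ n → P n
mod4-induction P p₀ p₁ p₂ p₃ step 0 = p₀
mod4-induction P p₀ p₁ p₂ p₃ step 1 = p₁
mod4-induction P p₀ p₁ p₂ p₃ step 2 = p₂
mod4-induction P p₀ p₁ p₂ p₃ step 3 = p₃
mod4-induction P p₀ p₁ p₂ p₃ step (suc (suc (suc (suc n)))) =
  step n (mod4-induction P p₀ p₁ p₂ p₃ step n)

bound-+4 : ∀ n → bound (4 + n) ≡ suc (bound n)
bound-+4 n = cong₂ _+_ (m/n≡1+[m∸n]/n {4 + n + 3} {4} (s≤s (s≤s (s≤s (s≤s z≤n)))))
                       (cong (λ r → if r ≡ᵇ 3 then 1 else 0)
                             (trans (cong (_% 4) (+-comm 4 n)) ([m+n]%n≡m%n n 4)))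

bound-suc≤ : ∀ n → bound (suc n) ≤ suc (bound n)
bound-suc≤ = mod4-induction _ (≤ᵇ⇒≤ _ _ tt) (≤ᵇ⇒≤ _ _ tt) (≤ᵇ⇒≤ _ _ tt) (≤ᵇ⇒≤ _ _ tt)
  λ n ih → subst₂ _≤_ (sym (bound-+4 (suc n))) (cong suc (sym (bound-+4 n))) (s≤s ih)

bound-+2≤ : ∀ n → bound (2 + n) ≤ suc (bound n)
bound-+2≤ = mod4-induction _ (≤ᵇ⇒≤ _ _ tt) (≤ᵇ⇒≤ _ _ tt) (≤ᵇ⇒≤ _ _ tt) (≤ᵇ⇒≤ _ _ tt)
  λ n ih → subst₂ _≤_ (sym (bound-+4 (2 + n))) (cong suc (sym (bound-+4 n))) (s≤s ih)

bound-≤-+2 : ∀ n → bound n ≤ bound (2 + n)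
bound-≤-+2 = mod4-induction _ (≤ᵇ⇒≤ _ _ tt) (≤ᵇ⇒≤ _ _ tt) (≤ᵇ⇒≤ _ _ tt) (≤ᵇ⇒≤ _ _ tt)
  λ n ih → subst₂ _≤_ (sym (bound-+4 n)) (sym (bound-+4 (2 + n))) (s≤s ih)

4*bound≤n+5 : ∀ n → 4 * bound n ≤ n + 5
4*bound≤n+5 = mod4-induction _ (≤ᵇ⇒≤ _ _ tt) (≤ᵇ⇒≤ _ _ tt) (≤ᵇ⇒≤ _ _ tt) (≤ᵇ⇒≤ _ _ tt)
  λ n ih → subst (_≤ 4 + n + 5) (sym (trans (cong (4 *_) (bound-+4 n)) (*-suc 4 (bound n))))
                 (+-monoʳ-≤ 4 ih)

bound-subadditive : ∀ m n → bound (m + n) ≤ bound m + bound n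
bound-subadditive = mod4-induction _ (λ _ → ≤-refl) bound-suc≤ bound-+2≤
  (λ n → ≤-trans (bound-suc≤ (2 + n)) (s≤s (bound-+2≤ n)))
  λ m ih n → subst₂ _≤_ (sym (bound-+4 (m + n))) (cong (_+ bound n) (sym (bound-+4 m)))
                        (s≤s (ih n))

bound-+2≤+1 : ∀ n → bound (2 + n) ≤ bound n + 1
bound-+2≤+1 n = subst (bound (2 + n) ≤_) (+-comm 1 (bound n)) (bound-+2≤ n)

bound-+4≤+1 : ∀ n → bound (4 + n) ≤ bound n + 1
bound-+4≤+1 n = ≤-reflexive (trans (bound-+4 n) (+-comm 1 (bound n)))

bound-+4≤+2+1 : ∀ n → bound (4 + n) ≤ bound (2 + n) + 1
bound-+4≤+2+1 n = subst₂ _≤_ (sym (bound-+4 n)) (+-comm 1 (bound (2 + n))) (s≤s (bound-≤-+2 n))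

bound-≤-budget : ∀ {n ℓ} → n + 5 ≤ 4 * ℓ → bound n ≤ ℓ
bound-≤-budget {n} h = *-cancelˡ-≤ 4 (≤-trans (4*bound≤n+5 n) h)

Row : Set
Row = List (Maybe Color)

sameColour : Color → Color → Bool
sameColour black black = true
sameColour white white = true
sameColour black white = false
sameColour white black = false

sameColour-refl : ∀ c → sameColour c c ≡ true
sameColour-refl black = refl
sameColour-refl white = refl

sameColour-opp : ∀ c → sameColour c (opp c) ≡ false
sameColour-opp black = refl
sameColour-opp white = refl

sameColour-opp˘ : ∀ c → sameColour (opp c) c ≡ false
sameColour-opp˘ black = refl
sameColour-opp˘ white = refl

data Relative (c : Color) : Color → Set where
  same-colour  : Relative c c
  other-colour : Relative c (opp c)

relative : ∀ c d → Relative c d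
relative black black = same-colour
relative black white = other-colour
relative white black = other-colour
relative white white = same-colour

-- The effective length of a block is its number of stones plus its number of
-- equal-coloured adjacent pairs.
increment : Bool → ℕ
increment true  = 2
increment false = 1

-- blockPotential c L u: a block of effective length L so far, whose last stone is c,
-- continued by the cells u.
mutual
  potential : Row → ℕ
  potential []            = 0
  potential (nothing ∷ u) = potential u
  potential (just c ∷ u)  = blockPotential c 1 u

  blockPotential : Color → ℕ → Row → ℕ
  blockPotential c L []            = bound L
  blockPotential c L (nothing ∷ u) = bound L + potential u
  blockPotential c L (just d ∷ u)  = blockPotential d (increment (sameColour c d) + L) u

-- TameBlock first c u: the block so far is tame, its last stone is c, and first says
-- whether it has a single stone; an equal-coloured pair anywhere but at the first
-- adjacency must end the block.
mutual
  TameRow : Row → Set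
  TameRow []            = ⊤
  TameRow (nothing ∷ u) = TameRow u
  TameRow (just c ∷ u)  = TameBlock true c u

  TameBlock : Bool → Color → Row → Set
  TameBlock first c []            = ⊤
  TameBlock first c (nothing ∷ u) = TameRow u
  TameBlock first c (just d ∷ u)  = TameNext first (sameColour c d) d u

  TameNext : Bool → Bool → Color → Row → Set
  TameNext true  _     d u = TameBlock false d u
  TameNext false false d u = TameBlock false d u
  TameNext false true  d u = BlockEnds u

  BlockEnds : Row → Set
  BlockEnds []            = ⊤
  BlockEnds (nothing ∷ u) = TameRow u
  BlockEnds (just _ ∷ _)  = ⊥

blockEnds⇒tameBlock : ∀ {first c} u → BlockEnds u → TameBlock first c u
blockEnds⇒tameBlock []            t = tt
blockEnds⇒tameBlock (nothing ∷ u) t = t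

tameNext⇒tameBlock : ∀ first s d u → TameNext first s d u → TameBlock false d u
tameNext⇒tameBlock true  _     d u t = t
tameNext⇒tameBlock false false d u t = t
tameNext⇒tameBlock false true  d u t = blockEnds⇒tameBlock u t

tameBlock⇒tameOpening : ∀ {first c} c′ u → TameBlock first c u → TameBlock true c′ u
tameBlock⇒tameOpening c′ []            t = tt
tameBlock⇒tameOpening c′ (nothing ∷ u) t = t
tameBlock⇒tameOpening {first} {c} c′ (just d ∷ u) t =
  tameNext⇒tameBlock first (sameColour c d) d u t

tameBlock⇒tameRow : ∀ {first c} u → TameBlock first c u → TameRow u
tameBlock⇒tameRow []            t = tt
tameBlock⇒tameRow (nothing ∷ u) t = t
tameBlock⇒tameRow {first} {c} (just d ∷ u) t =
  tameBlock⇒tameOpening d u (tameNext⇒tameBlock first (sameColour c d) d u t)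

blockPotential-subadditive : ∀ a b c u →
                             blockPotential c (b + a) u ≤ bound a + blockPotential c b u
blockPotential-subadditive a b c [] =
  subst (bound (b + a) ≤_) (+-comm (bound b) (bound a)) (bound-subadditive b a)
blockPotential-subadditive a b c (nothing ∷ u) = begin
  bound (b + a) + potential u        ≤⟨ +-monoˡ-≤ (potential u) (bound-subadditive b a) ⟩
  bound b + bound a + potential u    ≡⟨ cong (_+ potential u) (+-comm (bound b) (bound a)) ⟩
  bound a + bound b + potential u    ≡⟨ +-assoc (bound a) (bound b) (potential u) ⟩
  bound a + (bound b + potential u)  ∎
  where open ≤-Reasoning
blockPotential-subadditive a b c (just d ∷ u) =
  subst (λ L → blockPotential d L u ≤ bound a + blockPotential d (i + b) u) (+-assoc i b a)
        (blockPotential-subadditive a (i + b) d u)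
  where i = increment (sameColour c d)

blockEnds-≤ : ∀ c c′ L M K u → BlockEnds u → bound L ≤ bound M + bound K →
              blockPotential c L u ≤ bound M + blockPotential c′ K u
blockEnds-≤ c c′ L M K []            _ h = h
blockEnds-≤ c c′ L M K (nothing ∷ u) _ h =
  subst (bound L + potential u ≤_) (+-assoc (bound M) (bound K) (potential u))
        (+-monoˡ-≤ (potential u) h)

restart-block-≤ : ∀ a c u → TameBlock false (opp c) u →
                  blockPotential (opp c) (2 + a) u ≤ bound a + blockPotential c 1 u
restart-block-≤ a c []            t = blockEnds-≤ (opp c) c (2 + a) a 1 [] t (bound-+2≤+1 a)
restart-block-≤ a c (nothing ∷ u) t =
  blockEnds-≤ (opp c) c (2 + a) a 1 (nothing ∷ u) t (bound-+2≤+1 a)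
restart-block-≤ a c (just d ∷ u)  t with relative c d
... | same-colour rewrite sameColour-opp˘ c | sameColour-refl c =
  blockPotential-subadditive a 3 c u
... | other-colour rewrite sameColour-refl (opp c) | sameColour-opp c =
  blockEnds-≤ (opp c) (opp c) (4 + a) a 2 u t (bound-+4≤+1 a)

close-block-≤ : ∀ a c u → TameBlock false c u →
                blockPotential c (2 + a) u ≤ bound (2 + a) + potential u
close-block-≤ a c []            t = m≤m+n (bound (2 + a)) 0
close-block-≤ a c (nothing ∷ u) t = ≤-refl
close-block-≤ a c (just d ∷ u)  t with relative c d
... | same-colour rewrite sameColour-refl c =
  blockEnds-≤ c c (4 + a) (2 + a) 1 u t (bound-+4≤+2+1 a)
... | other-colour rewrite sameColour-opp c = blockPotential-subadditive (2 + a) 1 (opp c) u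

data Capture : Row → Row → Set where
  capture-right : ∀ c r → Capture (just c ∷ just (opp c) ∷ r) (nothing ∷ just c ∷ r)
  capture-left  : ∀ c r → Capture (just (opp c) ∷ just c ∷ r) (just c ∷ nothing ∷ r)
  beyond        : ∀ x {r r′} → Capture r r′ → Capture (x ∷ r) (x ∷ r′)

mutual
  potential-mono : ∀ {u v} → Capture u v → TameRow u → TameRow v × potential u ≤ potential v
  potential-mono (capture-right c r) t rewrite sameColour-opp c =
    tameBlock⇒tameOpening c r t , restart-block-≤ 0 c r t
  potential-mono (capture-left c r) t rewrite sameColour-opp˘ c =
    tameBlock⇒tameRow r t , close-block-≤ 0 c r t
  potential-mono (beyond nothing s) t = potential-mono s t
  potential-mono (beyond (just c) s) t = openingBlock-mono c s t

  openingBlock-mono : ∀ e {u v} → Capture u v → TameBlock true e u →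
                      TameBlock true e v × blockPotential e 1 u ≤ blockPotential e 1 v
  openingBlock-mono e (capture-right c r) t rewrite sameColour-opp c with sameColour e c
  ... | true  = tameBlock⇒tameOpening c r t , restart-block-≤ 2 c r t
  ... | false = tameBlock⇒tameOpening c r t , restart-block-≤ 1 c r t
  openingBlock-mono e (capture-left c r) t rewrite sameColour-opp˘ c with relative c e
  ... | same-colour rewrite sameColour-opp c | sameColour-refl c =
    tameBlock⇒tameRow r t , close-block-≤ 1 c r t
  ... | other-colour rewrite sameColour-refl (opp c) | sameColour-opp˘ c =
    tameBlock⇒tameRow r t , close-block-≤ 2 c r t
  openingBlock-mono e (beyond nothing s) t = map₂ (+-monoʳ-≤ (bound 1)) (potential-mono s t)
  openingBlock-mono e (beyond (just c) s) t =
    middleBlock-mono c (increment (sameColour e c) + 1) s t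

  middleBlock-mono : ∀ e L {u v} → Capture u v → TameBlock false e u →
                     TameBlock false e v × blockPotential e L u ≤ blockPotential e L v
  middleBlock-mono e L (capture-right c r) t with relative c e
  ... | same-colour rewrite sameColour-refl c = ⊥-elim t
  ... | other-colour rewrite sameColour-opp˘ c | sameColour-opp c =
    tameBlock⇒tameOpening c r t , restart-block-≤ L c r t
  middleBlock-mono e L (capture-left c r) t with relative c e
  ... | same-colour rewrite sameColour-opp c | sameColour-opp˘ c | sameColour-refl c =
    tameBlock⇒tameRow r t , close-block-≤ L c r t
  ... | other-colour rewrite sameColour-refl (opp c) = ⊥-elim t
  middleBlock-mono e L (beyond nothing s) t = map₂ (+-monoʳ-≤ (bound L)) (potential-mono s t)
  middleBlock-mono e L (beyond (just c) s) t with sameColour e c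
  ... | false = middleBlock-mono c (1 + L) s t
  ... | true  = closingBlock-mono c (2 + L) s t

  closingBlock-mono : ∀ e L {u v} → Capture u v → BlockEnds u →
                      BlockEnds v × blockPotential e L u ≤ blockPotential e L v
  closingBlock-mono e L (beyond nothing s) t = map₂ (+-monoʳ-≤ (bound L)) (potential-mono s t)

stoneCount : Row → ℕ
stoneCount u = length (filter (λ x → T? (is-just x)) u)

increment≤2 : ∀ s → increment s ≤ 2
increment≤2 true  = ≤-refl
increment≤2 false = s≤s z≤n

budget-increment : ∀ s {L ℓ} → L + 5 ≤ 4 * ℓ → increment s + L + 5 ≤ 4 * suc ℓ
budget-increment s {L} {ℓ} h = begin
  increment s + L + 5    ≡⟨ +-assoc (increment s) L 5 ⟩
  increment s + (L + 5)  ≤⟨ +-mono-≤ (≤-trans (increment≤2 s) (m≤m+n 2 2)) h ⟩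
  4 + 4 * ℓ              ≡⟨ *-suc 4 ℓ ⟨
  4 * suc ℓ              ∎
  where open ≤-Reasoning

-- In blockPotential≤stoneCount, ℓ is the number of stones of the current block so far.
mutual
  potential≤stoneCount : ∀ u → TameRow u → potential u ≤ stoneCount u
  potential≤stoneCount []                     t = z≤n
  potential≤stoneCount (nothing ∷ u)          t = potential≤stoneCount u t
  potential≤stoneCount (just c ∷ [])          t = s≤s z≤n
  potential≤stoneCount (just c ∷ nothing ∷ u) t = s≤s (potential≤stoneCount u t)
  potential≤stoneCount (just c ∷ just d ∷ u)  t =
    blockPotential≤stoneCount d (increment (sameColour c d) + 1) 2 u t
      (+-monoˡ-≤ 5 (+-monoˡ-≤ 1 (increment≤2 (sameColour c d))))

  blockPotential≤stoneCount : ∀ c L ℓ u → TameBlock false c u → L + 5 ≤ 4 * ℓ →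
                              blockPotential c L u ≤ ℓ + stoneCount u
  blockPotential≤stoneCount c L ℓ [] t h =
    subst (bound L ≤_) (sym (+-identityʳ ℓ)) (bound-≤-budget h)
  blockPotential≤stoneCount c L ℓ (nothing ∷ u) t h =
    +-mono-≤ (bound-≤-budget h) (potential≤stoneCount u t)
  blockPotential≤stoneCount c L ℓ (just d ∷ u) t h =
    subst (blockPotential c L (just d ∷ u) ≤_) (sym (+-suc ℓ (stoneCount u)))
      (blockPotential≤stoneCount d (increment s + L) (suc ℓ) u
        (tameNext⇒tameBlock false s d u t) (budget-increment s h))
    where s = sameColour c d

alternatingRow : Color → ℕ → Row
alternatingRow c zero    = []
alternatingRow c (suc n) = just c ∷ alternatingRow (opp c) n

toList-tabulate-alternating : ∀ n (f : ℕ → Color) → (∀ k → f (suc k) ≡ opp (f k)) →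
  toList (tabulate {n = n} (λ i → just (f (toℕ i)))) ≡ alternatingRow (f 0) n
toList-tabulate-alternating zero    f f-suc = refl
toList-tabulate-alternating (suc n) f f-suc = cong (just (f 0) ∷_)
  (trans (toList-tabulate-alternating n (λ k → f (suc k)) (λ k → f-suc (suc k)))
         (cong (λ c → alternatingRow c n) (f-suc 0)))

toList-alternating : ∀ n → toList (alternating n) ≡ alternatingRow black n
toList-alternating n = toList-tabulate-alternating n parity parity-suc
  where
  parity : ℕ → Color
  parity k = if isEven k then black else white

  parity-suc : ∀ k → parity (suc k) ≡ opp (parity k)
  parity-suc k with isEven k
  ... | true  = refl
  ... | false = refl

blockPotential-alternating : ∀ c L n → blockPotential c L (alternatingRow (opp c) n) ≡ bound (L + n)
blockPotential-alternating c L zero    = cong bound (sym (+-identityʳ L))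
blockPotential-alternating c L (suc n) rewrite sameColour-opp c =
  trans (blockPotential-alternating (opp c) (suc L) n) (cong bound (sym (+-suc L n)))

potential-alternating : ∀ c n → potential (alternatingRow c n) ≡ bound n
potential-alternating c zero    = refl
potential-alternating c (suc n) = blockPotential-alternating c 1 n

tameBlock-alternating : ∀ c n → TameBlock false c (alternatingRow (opp c) n)
tameBlock-alternating c zero    = tt
tameBlock-alternating c (suc n) rewrite sameColour-opp c = tameBlock-alternating (opp c) n

tameRow-alternating : ∀ c n → TameRow (alternatingRow c n)
tameRow-alternating c zero    = tt
tameRow-alternating c (suc n) =
  tameBlock⇒tameOpening c (alternatingRow (opp c) n) (tameBlock-alternating c n)

move⇒capture : ∀ {n} (b : Board n) (i j : Fin n) (c : Color) → Adj i j →
               lookup b i ≡ just c → lookup b j ≡ just (opp c) →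
               Capture (toList b) (toList ((b [ j ]≔ just c) [ i ]≔ nothing))
move⇒capture b fzero fzero c (inj₁ ()) _ _
move⇒capture b fzero fzero c (inj₂ ()) _ _
move⇒capture (x ∷ y ∷ b) fzero (fsuc fzero) c _ refl refl = capture-right c (toList b)
move⇒capture b fzero (fsuc (fsuc j)) c (inj₁ ()) _ _
move⇒capture b fzero (fsuc j) c (inj₂ ()) _ _
move⇒capture (x ∷ y ∷ b) (fsuc fzero) fzero c _ refl refl = capture-left c (toList b)
move⇒capture b (fsuc i) fzero c (inj₁ ()) _ _
move⇒capture b (fsuc (fsuc i)) fzero c (inj₂ ()) _ _
move⇒capture (x ∷ b) (fsuc i) (fsuc j) c (inj₁ p) eᵢ eⱼ =
  beyond x (move⇒capture b i j c (inj₁ (suc-injective p)) eᵢ eⱼ)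
move⇒capture (x ∷ b) (fsuc i) (fsuc j) c (inj₂ p) eᵢ eⱼ =
  beyond x (move⇒capture b i j c (inj₂ (suc-injective p)) eᵢ eⱼ)

reachable-mono : ∀ {n} {b b′ : Board n} → Reachable b b′ → TameRow (toList b) →
                 TameRow (toList b′) × potential (toList b) ≤ potential (toList b′)
reachable-mono ε t = t , ≤-refl
reachable-mono (move b i j c adj eᵢ eⱼ ◅ path) t =
  let t₁ , p₁ = potential-mono (move⇒capture b i j c adj eᵢ eⱼ) t
      t₂ , p₂ = reachable-mono path t₁
  in t₂ , ≤-trans p₁ p₂

theorem2 : (n k : ℕ) → 1 ≤ n → ReducesTo (alternating n) k → bound n ≤ k
theorem2 n k _ (b′ , path , _ , refl) = begin
  bound n                            ≡⟨ potential-alternating black n ⟨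
  potential (alternatingRow black n) ≡⟨ cong potential (toList-alternating n) ⟨
  potential (toList (alternating n)) ≤⟨ proj₂ final ⟩
  potential (toList b′)              ≤⟨ potential≤stoneCount (toList b′) (proj₁ final) ⟩
  stones b′                          ∎
  where
  open ≤-Reasoning
  final : TameRow (toList b′) × potential (toList (alternating n)) ≤ potential (toList b′)
  final = reachable-mono path
            (subst TameRow (sym (toList-alternating n)) (tameRow-alternating black n))
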